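{- Let $P$ be a finite set of $n$ points partitioned into groups $\mathbf{g}_1,\dots,\mathbf{g}_k$, and let $h:P\to\{1,\dots,m\}$. For bucket $j$ let $n_j$ be the number of points of $P$ mapped to $j$ and $\alpha_{i,j}$ the number of points of $\mathbf{g}_i$ mapped to $j$. If $\sum_{j=1}^m (n_j/n)^2=\frac1m$, then for every group $i\in\{1,\dots,k\}$, $\sum_{j=1}^m \frac{\alpha_{i,j}}{|\mathbf{g}_i|}\cdot\frac{n_j}{n}=\frac1m$.
   Context: $\sum_j (n_j/n)^2$ is the collision probability $\Pr[h(p)=h(q)]$ for $p,q$ independent uniform from $P$; $\sum_j \frac{\alpha_{i,j}}{|\mathbf{g}_i|}\frac{n_j}{n}$ is the single-fairness probability of group $i$, namely $\Pr[h(p)=h(x)]$ for $p$ uniform from $\mathbf{g}_i$ and $x$ independent uniform from $P$. "Collision probability is satisfied" means it equals $1/m$; "single fairness is satisfied" means the single-fairness probability equals $1/m$ for every group. -}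

module Defs where

open import Data.Nat using (ℕ; zero; suc; _+_)
open import Data.Fin using (Fin; zero; suc; _≟_)
open import Data.Rational using (ℚ; 0ℚ) renaming (_+_ to _+ℚ_)
open import Relation.Nullary using (yes; no)

fibreSize : {n k : ℕ} → (Fin n → Fin k) → Fin k → ℕ
fibreSize {zero}  f j = 0
fibreSize {suc n} f j with f zero ≟ j
... | yes _ = suc (fibreSize (λ x → f (suc x)) j)
... | no  _ = fibreSize (λ x → f (suc x)) j

jointSize : {n k m : ℕ} → (Fin n → Fin k) → (Fin n → Fin m) → Fin k → Fin m → ℕ
jointSize {zero}  g h i j = 0
jointSize {suc n} g h i j with g zero ≟ i | h zero ≟ j
... | yes _ | yes _ = suc (jointSize (λ x → g (suc x)) (λ x → h (suc x)) i j)
... | _     | _     = jointSize (λ x → g (suc x)) (λ x → h (suc x)) i j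

sumℚ : {m : ℕ} → (Fin m → ℚ) → ℚ
sumℚ {zero}  f = 0ℚ
sumℚ {suc m} f = f zero +ℚ sumℚ (λ j → f (suc j))

module Submission where

-- With x_j = n_j / n we have Σ x_j = 1, and Σ (x_j - 1/m)² = Σ x_j² - 2/m + 1/m,
-- so collision probability 1/m forces every x_j to equal 1/m: all buckets have the
-- same size.  The single-fairness sum of group i is then (1/m) Σ_j α_{i,j} / |g_i|,
-- and Σ_j α_{i,j} = |g_i|.

open import Defs
open import Algebra.Bundles using (CommutativeRing)
import Algebra.Properties.Group as GroupProperties
import Algebra.Properties.Semiring.Sum as SemiringSum
open import Data.Fin using (Fin; zero; suc; _≟_)
open import Data.Integer as ℤ using (+_)
import Data.Integer.Properties as ℤP
import Data.Integer.Tactic.RingSolver as ℤ-Solver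
open import Data.Nat as ℕ using (ℕ; zero; suc; NonZero)
import Data.Nat.Properties as ℕP
open import Data.Rational as ℚ using (ℚ; _/_; _+_; _*_; _-_; -_; _≤_; 0ℚ; 1ℚ; fromℚᵘ; toℚᵘ)
import Data.Rational.Properties as ℚP
import Data.Rational.Unnormalised as ℚᵘ
import Data.Rational.Unnormalised.Properties as ℚᵘP
open import Data.Sum using (inj₁; inj₂)
open import Function using (_∘_)
open import Level using (0ℓ)
open import Relation.Binary.PropositionalEquality
open import Relation.Nullary using (Dec; yes; no)
open import Relation.Nullary.Decidable using (dec⇒maybe)
import Tactic.RingSolver as RingSolver
import Tactic.RingSolver.Core.AlmostCommutativeRing as ACR

module ℕΣ = SemiringSum ℕP.+-*-semiring
module ℚΣ = SemiringSum (CommutativeRing.semiring ℚP.+-*-commutativeRing)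

ℚ-ring : ACR.AlmostCommutativeRing 0ℓ 0ℓ
ℚ-ring = ACR.fromCommutativeRing ℚP.+-*-commutativeRing (dec⇒maybe ∘ (0ℚ ℚP.≟_))

sumℚ≡∑ : ∀ {m} (f : Fin m → ℚ) → sumℚ f ≡ ℚΣ.sum f
sumℚ≡∑ {zero}  f = refl
sumℚ≡∑ {suc m} f = cong (ℚ._+_ (f zero)) (sumℚ≡∑ (f ∘ suc))

indicator : ∀ {p} {P : Set p} → Dec P → ℕ
indicator (yes _) = 1
indicator (no _)  = 0

∑-indicator-≟ : ∀ {m} (a : Fin m) → ℕΣ.sum (λ j → indicator (a ≟ j)) ≡ 1
∑-indicator-≟ {suc m} zero    = cong suc (ℕΣ.sum-replicate-zero m)
∑-indicator-≟ {suc m} (suc a) = trans (ℕΣ.sum-cong-≗ shift) (∑-indicator-≟ a)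
  where
  shift : ∀ j → indicator (suc a ≟ suc j) ≡ indicator (a ≟ j)
  shift j with a ≟ j
  ... | yes _ = refl
  ... | no _  = refl

∑-const-1 : ∀ m → ℕΣ.sum {m} (λ _ → 1) ≡ m
∑-const-1 zero    = refl
∑-const-1 (suc m) = cong suc (∑-const-1 m)

fibreSize-suc : ∀ {n m} (f : Fin (suc n) → Fin m) j →
  fibreSize f j ≡ indicator (f zero ≟ j) ℕ.+ fibreSize (f ∘ suc) j
fibreSize-suc f j with f zero ≟ j
... | yes _ = refl
... | no _  = refl

jointSize-suc : ∀ {n k m} (g : Fin (suc n) → Fin k) (h : Fin (suc n) → Fin m) i j →
  jointSize g h i j ≡
    indicator (g zero ≟ i) ℕ.* indicator (h zero ≟ j) ℕ.+ jointSize (g ∘ suc) (h ∘ suc) i j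
jointSize-suc g h i j with g zero ≟ i | h zero ≟ j
... | yes _ | yes _ = refl
... | yes _ | no _  = refl
... | no _  | yes _ = refl
... | no _  | no _  = refl

∑-fibreSize : ∀ {n m} (f : Fin n → Fin m) → ℕΣ.sum (fibreSize f) ≡ n
∑-fibreSize {zero}  {m} f = ℕΣ.sum-replicate-zero m
∑-fibreSize {suc n}     f = begin
  ℕΣ.sum (fibreSize f)
    ≡⟨ ℕΣ.sum-cong-≗ (fibreSize-suc f) ⟩
  ℕΣ.sum (λ j → indicator (f zero ≟ j) ℕ.+ fibreSize (f ∘ suc) j)
    ≡⟨ ℕΣ.∑-distrib-+ (λ j → indicator (f zero ≟ j)) (fibreSize (f ∘ suc)) ⟩
  ℕΣ.sum (λ j → indicator (f zero ≟ j)) ℕ.+ ℕΣ.sum (fibreSize (f ∘ suc))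
    ≡⟨ cong₂ ℕ._+_ (∑-indicator-≟ (f zero)) (∑-fibreSize (f ∘ suc)) ⟩
  suc n ∎
  where open ≡-Reasoning

∑-jointSize : ∀ {n k m} (g : Fin n → Fin k) (h : Fin n → Fin m) i →
  ℕΣ.sum (jointSize g h i) ≡ fibreSize g i
∑-jointSize {zero}  {m = m} g h i = ℕΣ.sum-replicate-zero m
∑-jointSize {suc n}         g h i = begin
  ℕΣ.sum (jointSize g h i)
    ≡⟨ ℕΣ.sum-cong-≗ (jointSize-suc g h i) ⟩
  ℕΣ.sum (λ j → δ ℕ.* indicator (h zero ≟ j) ℕ.+ jointSize (g ∘ suc) (h ∘ suc) i j)
    ≡⟨ ℕΣ.∑-distrib-+ (λ j → δ ℕ.* indicator (h zero ≟ j)) (jointSize (g ∘ suc) (h ∘ suc) i) ⟩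
  ℕΣ.sum (λ j → δ ℕ.* indicator (h zero ≟ j)) ℕ.+ ℕΣ.sum (jointSize (g ∘ suc) (h ∘ suc) i)
    ≡⟨ cong₂ ℕ._+_ (sym (ℕΣ.*-distribˡ-sum δ (λ j → indicator (h zero ≟ j)))) (∑-jointSize (g ∘ suc) (h ∘ suc) i) ⟩
  δ ℕ.* ℕΣ.sum (λ j → indicator (h zero ≟ j)) ℕ.+ fibreSize (g ∘ suc) i
    ≡⟨ cong (λ s → δ ℕ.* s ℕ.+ fibreSize (g ∘ suc) i) (∑-indicator-≟ (h zero)) ⟩
  δ ℕ.* 1 ℕ.+ fibreSize (g ∘ suc) i
    ≡⟨ cong (ℕ._+ fibreSize (g ∘ suc) i) (ℕP.*-identityʳ δ) ⟩
  δ ℕ.+ fibreSize (g ∘ suc) i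
    ≡⟨ fibreSize-suc g i ⟨
  fibreSize g i ∎
  where
  open ≡-Reasoning
  δ = indicator (g zero ≟ i)

fromℚᵘ-homo-+ : ∀ p q → fromℚᵘ (p ℚᵘ.+ q) ≡ fromℚᵘ p + fromℚᵘ q
fromℚᵘ-homo-+ p q = ℚP.toℚᵘ-injective (begin
  toℚᵘ (fromℚᵘ (p ℚᵘ.+ q))             ≈⟨ ℚP.toℚᵘ-fromℚᵘ (p ℚᵘ.+ q) ⟩
  p ℚᵘ.+ q                              ≈⟨ ℚᵘP.+-cong (ℚP.toℚᵘ-fromℚᵘ p) (ℚP.toℚᵘ-fromℚᵘ q) ⟨
  toℚᵘ (fromℚᵘ p) ℚᵘ.+ toℚᵘ (fromℚᵘ q)  ≈⟨ ℚP.toℚᵘ-homo-+ (fromℚᵘ p) (fromℚᵘ q) ⟨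
  toℚᵘ (fromℚᵘ p + fromℚᵘ q)            ∎)
  where open ℚᵘP.≃-Reasoning

+-distrib-/ : ∀ i j d .{{_ : NonZero d}} → (i ℤ.+ j) / d ≡ i / d + j / d
+-distrib-/ i j d@(suc _) =
  trans (ℚP.fromℚᵘ-cong {(i ℤ.+ j) ℚᵘ./ d} {i ℚᵘ./ d ℚᵘ.+ j ℚᵘ./ d} (ℚᵘ.*≡* cross))
        (fromℚᵘ-homo-+ (i ℚᵘ./ d) (j ℚᵘ./ d))
  where
  distrib : ∀ a b c → (a ℤ.+ b) ℤ.* (c ℤ.* c) ≡ (a ℤ.* c ℤ.+ b ℤ.* c) ℤ.* c
  distrib = ℤ-Solver.solve-∀
  cross : (i ℤ.+ j) ℤ.* + (d ℕ.* d) ≡ (i ℤ.* + d ℤ.+ j ℤ.* + d) ℤ.* + d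
  cross = trans (cong ((i ℤ.+ j) ℤ.*_) (sym (ℤP.pos-* d d))) (distrib i j (+ d))

n/n≡1 : ∀ n .{{_ : NonZero n}} → + n / n ≡ 1ℚ
n/n≡1 n@(suc _) = ℚP.fromℚᵘ-cong {+ n ℚᵘ./ n} {ℚᵘ.1ℚᵘ} (ℚᵘ.*≡* (ℤP.*-comm (+ n) (+ 1)))

∑-distrib-/ : ∀ {m} d .{{_ : NonZero d}} (a : Fin m → ℕ) →
  + ℕΣ.sum a / d ≡ ℚΣ.sum (λ j → + a j / d)
∑-distrib-/ {zero}  d a = ℚP.0/n≡0 d
∑-distrib-/ {suc m} d a =
  trans (+-distrib-/ (+ a zero) (+ ℕΣ.sum (a ∘ suc)) d) (cong (ℚ._+_ (+ a zero / d)) (∑-distrib-/ d (a ∘ suc)))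

∑≡d⇒∑/d≡1 : ∀ {m} d .{{_ : NonZero d}} (a : Fin m → ℕ) →
  ℕΣ.sum a ≡ d → ℚΣ.sum (λ j → + a j / d) ≡ 1ℚ
∑≡d⇒∑/d≡1 d a ∑a≡d = begin
  ℚΣ.sum (λ j → + a j / d) ≡⟨ ∑-distrib-/ d a ⟨
  + ℕΣ.sum a / d           ≡⟨ cong (λ s → + s / d) ∑a≡d ⟩
  + d / d                  ≡⟨ n/n≡1 d ⟩
  1ℚ                       ∎
  where open ≡-Reasoning

0≤p*p : ∀ p → 0ℚ ≤ p * p
0≤p*p p with ℚP.≤-total 0ℚ p
... | inj₁ 0≤p = ℚP.nonNegative⁻¹ (p * p) {{ℚP.nonNeg*nonNeg⇒nonNeg p p}}
  where instance _ = ℚ.nonNegative 0≤p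
... | inj₂ p≤0 = ℚP.nonNegative⁻¹ (p * p) {{ℚP.nonPos*nonPos⇒nonPos p p}}
  where instance _ = ℚ.nonPositive p≤0

p*p≡0⇒p≡0 : ∀ p → p * p ≡ 0ℚ → p ≡ 0ℚ
p*p≡0⇒p≡0 p p*p≡0 with p ℚP.≟ 0ℚ
... | yes p≡0 = p≡0
... | no  p≢0 = begin
  p                 ≡⟨ ℚP.*-identityʳ p ⟨
  p * 1ℚ            ≡⟨ cong (p *_) (ℚP.*-inverseʳ p) ⟨
  p * (p * ℚ.1/ p)  ≡⟨ ℚP.*-assoc p p (ℚ.1/ p) ⟨
  p * p * ℚ.1/ p    ≡⟨ cong (_* ℚ.1/ p) p*p≡0 ⟩
  0ℚ * ℚ.1/ p       ≡⟨ ℚP.*-zeroˡ (ℚ.1/ p) ⟩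
  0ℚ                ∎
  where
  open ≡-Reasoning
  instance _ = ℚ.≢-nonZero p≢0

∑-nonNeg : ∀ {m} (f : Fin m → ℚ) → (∀ j → 0ℚ ≤ f j) → 0ℚ ≤ ℚΣ.sum f
∑-nonNeg {zero}  f f≥0 = ℚP.≤-refl
∑-nonNeg {suc m} f f≥0 = ℚP.+-mono-≤ (f≥0 zero) (∑-nonNeg (f ∘ suc) (f≥0 ∘ suc))

nonNeg+nonNeg≡0⇒≡0 : ∀ {p q} → 0ℚ ≤ p → 0ℚ ≤ q → p + q ≡ 0ℚ → p ≡ 0ℚ
nonNeg+nonNeg≡0⇒≡0 {p} {q} 0≤p 0≤q p+q≡0 = ℚP.≤-antisym p≤0 0≤p
  where
  open ℚP.≤-Reasoning
  p≤0 : p ≤ 0ℚ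
  p≤0 = begin
    p       ≡⟨ ℚP.+-identityʳ p ⟨
    p + 0ℚ  ≤⟨ ℚP.+-monoʳ-≤ p 0≤q ⟩
    p + q   ≡⟨ p+q≡0 ⟩
    0ℚ      ∎

∑-nonNeg≡0⇒≡0 : ∀ {m} (f : Fin m → ℚ) → (∀ j → 0ℚ ≤ f j) → ℚΣ.sum f ≡ 0ℚ → ∀ j → f j ≡ 0ℚ
∑-nonNeg≡0⇒≡0 {suc m} f f≥0 ∑f≡0 = λ where
    zero    → f₀≡0
    (suc j) → ∑-nonNeg≡0⇒≡0 (f ∘ suc) (f≥0 ∘ suc) ∑tail≡0 j
  where
  f₀≡0 : f zero ≡ 0ℚ
  f₀≡0 = nonNeg+nonNeg≡0⇒≡0 (f≥0 zero) (∑-nonNeg (f ∘ suc) (f≥0 ∘ suc)) ∑f≡0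
  ∑tail≡0 : ℚΣ.sum (f ∘ suc) ≡ 0ℚ
  ∑tail≡0 = trans (sym (ℚP.+-identityˡ _)) (trans (cong (_+ ℚΣ.sum (f ∘ suc)) (sym f₀≡0)) ∑f≡0)

∑≡1∧∑²≡u⇒≡u : ∀ {m} (x : Fin m → ℚ) u →
  ℚΣ.sum {m} (λ _ → u) ≡ 1ℚ → ℚΣ.sum x ≡ 1ℚ → ℚΣ.sum (λ j → x j * x j) ≡ u → ∀ j → x j ≡ u
∑≡1∧∑²≡u⇒≡u {m} x u ∑u≡1 ∑x≡1 ∑x²≡u j =
  x∙y⁻¹≈ε⇒x≈y (x j) u (p*p≡0⇒p≡0 (x j - u) (∑-nonNeg≡0⇒≡0 square (0≤p*p ∘ deviation) ∑square≡0 j))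
  where
  open GroupProperties (CommutativeRing.+-group ℚP.+-*-commutativeRing) using (x∙y⁻¹≈ε⇒x≈y)
  open ≡-Reasoning
  deviation : Fin m → ℚ
  deviation j = x j - u
  square : Fin m → ℚ
  square j = deviation j * deviation j
  c : ℚ
  c = - (u + u)
  expand : ∀ x u → (x - u) * (x - u) ≡ x * x + (- (u + u) * x + u * u)
  expand = RingSolver.solve-∀ ℚ-ring
  collapse : ∀ u → u + (- (u + u) * 1ℚ + u * 1ℚ) ≡ 0ℚ
  collapse = RingSolver.solve-∀ ℚ-ring
  ∑square≡0 : ℚΣ.sum square ≡ 0ℚ
  ∑square≡0 = begin
    ℚΣ.sum square
      ≡⟨ ℚΣ.sum-cong-≗ (λ j → expand (x j) u) ⟩
    ℚΣ.sum (λ j → x j * x j + (c * x j + u * u))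
      ≡⟨ ℚΣ.∑-distrib-+ (λ j → x j * x j) (λ j → c * x j + u * u) ⟩
    ℚΣ.sum (λ j → x j * x j) + ℚΣ.sum (λ j → c * x j + u * u)
      ≡⟨ cong (ℚ._+_ (ℚΣ.sum (λ j → x j * x j))) (ℚΣ.∑-distrib-+ (λ j → c * x j) (λ (_ : Fin m) → u * u)) ⟩
    ℚΣ.sum (λ j → x j * x j) + (ℚΣ.sum (λ j → c * x j) + ℚΣ.sum (λ (_ : Fin m) → u * u))
      ≡⟨ cong₂ (λ a b → ℚΣ.sum (λ j → x j * x j) + (a + b))
               (sym (ℚΣ.*-distribˡ-sum c x)) (sym (ℚΣ.*-distribˡ-sum u (λ (_ : Fin m) → u))) ⟩
    ℚΣ.sum (λ j → x j * x j) + (c * ℚΣ.sum x + u * ℚΣ.sum {m} (λ _ → u))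
      ≡⟨ cong₂ (λ a b → a + (c * b + u * ℚΣ.sum {m} (λ _ → u))) ∑x²≡u ∑x≡1 ⟩
    u + (c * 1ℚ + u * ℚΣ.sum {m} (λ _ → u))
      ≡⟨ cong (λ b → u + (c * 1ℚ + u * b)) ∑u≡1 ⟩
    u + (c * 1ℚ + u * 1ℚ)
      ≡⟨ collapse u ⟩
    0ℚ ∎

proposition2p2 : (n k m : ℕ) → .{{_ : NonZero n}} → .{{_ : NonZero m}} →
    (g : Fin n → Fin k) → (h : Fin n → Fin m) →
    (ne : (i : Fin k) → NonZero (fibreSize g i)) →
    sumℚ (λ j → ((+ fibreSize h j) / n) * ((+ fibreSize h j) / n)) ≡ (+ 1) / m →
    (i : Fin k) →
      sumℚ (λ j → (_/_ (+ jointSize g h i j) (fibreSize g i) {{ne i}}) * ((+ fibreSize h j) / n)) ≡ (+ 1) / m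
proposition2p2 n k m g h ne ∑x²≡u i = begin
  sumℚ (λ j → y j * x j)   ≡⟨ sumℚ≡∑ (λ j → y j * x j) ⟩
  ℚΣ.sum (λ j → y j * x j) ≡⟨ ℚΣ.sum-cong-≗ (λ j → cong (y j *_) (x≡u j)) ⟩
  ℚΣ.sum (λ j → y j * u)   ≡⟨ ℚΣ.*-distribʳ-sum u y ⟨
  ℚΣ.sum y * u             ≡⟨ cong (_* u) ∑y≡1 ⟩
  1ℚ * u                   ≡⟨ ℚP.*-identityˡ u ⟩
  u                        ∎
  where
  open ≡-Reasoning
  x : Fin m → ℚ
  x j = + fibreSize h j / n
  u : ℚ
  u = + 1 / m
  y : Fin m → ℚ
  y j = (+ jointSize g h i j / fibreSize g i) {{ne i}}
  ∑y≡1 : ℚΣ.sum y ≡ 1ℚ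
  ∑y≡1 = ∑≡d⇒∑/d≡1 (fibreSize g i) {{ne i}} (jointSize g h i) (∑-jointSize g h i)
  x≡u : ∀ j → x j ≡ u
  x≡u = ∑≡1∧∑²≡u⇒≡u x u (∑≡d⇒∑/d≡1 m (λ (_ : Fin m) → 1) (∑-const-1 m)) (∑≡d⇒∑/d≡1 n (fibreSize h) (∑-fibreSize h))
          (trans (sym (sumℚ≡∑ (λ j → x j * x j))) ∑x²≡u)
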